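{- Let $\lambda$ be a partition with at most $n$ parts, let $\beta,\beta'\in U_\lambda(n)$, and set $\delta:=\Delta_\lambda(\beta)\in UI_\lambda(n)$. (i) $\mathcal{S}_\lambda(\beta)=[Q_\lambda(\beta)]=\{T\in\mathcal{T}_\lambda:T\le Q_\lambda(\beta)\}$; hence $\mathcal{S}_\lambda(\beta)=\mathcal{S}_\lambda(\beta')$ if and only if $Q_\lambda(\beta)=Q_\lambda(\beta')$. (ii) $M_\lambda(\delta)=Q_\lambda(\beta)$, and hence $\mathcal{S}_\lambda(\beta)=[M_\lambda(\delta)]$.
   Context: Fix $n\ge1$; $[m]=\{1,\dots,m\}$, $(a,b]=\{a+1,\dots,b\}$. Partition $\lambda=(\lambda_1\ge\cdots\ge\lambda_n\ge0)$; boxes $(j,i)$, $1\le j\le\lambda_1$, $1\le i\le\zeta_j=\#\{i:\lambda_i\ge j\}$. $R_\lambda=\{q_1<\cdots<q_r\}\subseteq[n-1]$ = column lengths less than $n$; $q_0=0$, $q_{r+1}=n$; carrels $(q_{h-1},q_h]$. $\lambda$-tuples $\nu\in[n]^n$; $U_\lambda(n)$ upper ones ($\nu_i\ge i$); $UI_\lambda(n)$ upper ones strictly increasing on each carrel. Critical indices of $\upsilon\in U_\lambda(n)$: in carrel $h$, $x_1=q_h$, and while possible $x_u$ = largest $x\in(q_{h-1},x_{u-1})$ with $\upsilon_{x_{u-1}}-\upsilon_x>x_{u-1}-x$. Core $\Delta_\lambda(\upsilon)$: equals $\upsilon_x$ at critical $x$ and $\upsilon_x-(x-i)$ at non-critical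 $i$, $x$ the smallest critical index $>i$. Tableaux: $T_j(i)\in[n]$ strictly increasing down columns, weakly along rows; $\mathcal{T}_\lambda$, ordered entrywise (a lattice with join = entrywise max). $\mathcal{S}_\lambda(\beta)=\{T\in\mathcal{T}_\lambda:T_j(i)\le\beta_i\ \forall(j,i)\}$; $Q_\lambda(\beta)$ is the least upper bound in $\mathcal{T}_\lambda$ of $\mathcal{S}_\lambda(\beta)$. For $\alpha\in UI_\lambda(n)$, $M_\lambda(\alpha)$ is the maximum element of $\{T\in\mathcal{T}_\lambda:T_{\lambda_i}(i)=\alpha_i\text{ for all }i\text{ with }\lambda_i\ge1\}$ (nonempty and closed under join). -}

module Defs where

-- Conventions: everything is 1-based and indexed by ℕ.
--  * n : ℕ is fixed (n ≥ 1 is a hypothesis of the theorem).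
--  * A partition λ = (λ₁ ≥ … ≥ λₙ ≥ 0) is a function lam : ℕ → ℕ of which
--    only the values lam 1 … lam n are meaningful.
--  * An n-tuple ν ∈ [n]^n is a function ν : ℕ → ℕ of which only ν 1 … ν n
--    are meaningful.
--  * A tableau is a function T : ℕ → ℕ → ℕ, T j i = T_j(i) (column j, row i),
--    of which only the values on boxes (j , i) of λ are meaningful; hence
--    equality / order of tableaux is tested on boxes only.

open import Data.Nat using (ℕ; zero; suc; _+_; _∸_; _≤_; _<_; _≡ᵇ_; _<ᵇ_; _≤ᵇ_)
open import Data.Bool using (Bool; true; false; if_then_else_; _∧_; _∨_)
open import Data.Maybe using (Maybe; just; nothing)
open import Data.Product using (_×_; Σ)
open import Relation.Binary.PropositionalEquality using (_≡_)

count : (ℕ → Bool) → ℕ → ℕ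
count p zero = zero
count p (suc m) = (if p (suc m) then 1 else 0) + count p m

anyIn : (ℕ → Bool) → ℕ → Bool
anyIn p zero = false
anyIn p (suc m) = p (suc m) ∨ anyIn p m

firstIn : (ℕ → Bool) → ℕ → ℕ → ℕ
firstIn p a zero = a
firstIn p a (suc k) = if p a then a else firstIn p (suc a) k

lastUpTo : (ℕ → Bool) → ℕ → ℕ
lastUpTo p zero = zero
lastUpTo p (suc y) = if p (suc y) then suc y else lastUpTo p y

searchDown : (ℕ → Bool) → ℕ → ℕ → Maybe ℕ
searchDown p lo zero = nothing
searchDown p lo (suc y) =
  if lo <ᵇ suc y then (if p (suc y) then just (suc y) else searchDown p lo y)
  else nothing

IsPartition : ℕ → (ℕ → ℕ) → Set
IsPartition n lam = ∀ i → 1 ≤ i → i < n → lam (suc i) ≤ lam i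

ζ : ℕ → (ℕ → ℕ) → ℕ → ℕ
ζ n lam j = count (λ i → j ≤ᵇ lam i) n

inR : ℕ → (ℕ → ℕ) → ℕ → Bool
inR n lam q = (q <ᵇ n) ∧ anyIn (λ j → ζ n lam j ≡ᵇ q) (lam 1)

-- for x ∈ [n] lying in the carrel (q_{h-1}, q_h]:
--   carrelTop x = q_h = least element of R_λ ∪ {n} that is ≥ x
--   carrelBot x = q_{h-1} = largest element of R_λ ∪ {0} that is < x
carrelTop : ℕ → (ℕ → ℕ) → ℕ → ℕ
carrelTop n lam x = firstIn (λ q → inR n lam q ∨ (q ≡ᵇ n)) x (n ∸ x)

carrelBot : ℕ → (ℕ → ℕ) → ℕ → ℕ
carrelBot n lam x = lastUpTo (inR n lam) (x ∸ 1)

IsTuple : ℕ → (ℕ → ℕ) → Set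
IsTuple n ν = ∀ i → 1 ≤ i → i ≤ n → 1 ≤ ν i × ν i ≤ n

InU : ℕ → (ℕ → ℕ) → (ℕ → ℕ) → Set
InU n lam ν = IsTuple n ν × (∀ i → 1 ≤ i → i ≤ n → i ≤ ν i)

InUI : ℕ → (ℕ → ℕ) → (ℕ → ℕ) → Set
InUI n lam ν = InU n lam ν ×
  (∀ i → 1 ≤ i → suc i ≤ n →
     carrelTop n lam i ≡ carrelTop n lam (suc i) → ν i < ν (suc i))

-- next critical index below the critical index y (in a carrel with lower
-- end lo): the largest x ∈ (lo, y) with υ_y - υ_x > y - x,
-- i.e. (over ℕ, x < y) υ_x + y < υ_y + x
nextCrit : (ℕ → ℕ) → ℕ → ℕ → Maybe ℕ
nextCrit υ lo y = searchDown (λ x → (υ x + y) <ᵇ (υ y + x)) lo (y ∸ 1)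

-- critFrom fuel lo y x : does x occur in the chain of critical indices
-- y = x_u, x_{u+1}, … (lower carrel end lo)?  (the chain strictly
-- decreases, so fuel n suffices)
critFrom : (ℕ → ℕ) → ℕ → ℕ → ℕ → ℕ → Bool
critFrom υ zero lo y x = x ≡ᵇ y
critFrom υ (suc fuel) lo y x with x ≡ᵇ y
... | true = true
... | false with nextCrit υ lo y
...   | nothing = false
...   | just y' = critFrom υ fuel lo y' x

isCritical : ℕ → (ℕ → ℕ) → (ℕ → ℕ) → ℕ → Bool
isCritical n lam υ x =
  critFrom υ n (carrelBot n lam x) (carrelTop n lam x) x

nextCriticalAbove : ℕ → (ℕ → ℕ) → (ℕ → ℕ) → ℕ → ℕ
nextCriticalAbove n lam υ i =
  firstIn (isCritical n lam υ) (suc i) (n ∸ suc i)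

Δ : ℕ → (ℕ → ℕ) → (ℕ → ℕ) → (ℕ → ℕ)
Δ n lam υ i =
  if isCritical n lam υ i then υ i
  else (let x = nextCriticalAbove n lam υ i in υ x ∸ (x ∸ i))

Box : ℕ → (ℕ → ℕ) → ℕ → ℕ → Set
Box n lam j i = (1 ≤ i × i ≤ n) × (1 ≤ j × j ≤ lam i)

Tab : Set
Tab = ℕ → ℕ → ℕ

IsTableau : ℕ → (ℕ → ℕ) → Tab → Set
IsTableau n lam T =
  (∀ j i → Box n lam j i → 1 ≤ T j i × T j i ≤ n) ×
  (∀ j i → Box n lam j i → Box n lam j (suc i) → T j i < T j (suc i)) ×
  (∀ j i → Box n lam j i → Box n lam (suc j) i → T j i ≤ T (suc j) i)

_≤T[_,_]_ : Tab → ℕ → (ℕ → ℕ) → Tab → Set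
T ≤T[ n , lam ] T' = ∀ j i → Box n lam j i → T j i ≤ T' j i

_≈T[_,_]_ : Tab → ℕ → (ℕ → ℕ) → Tab → Set
T ≈T[ n , lam ] T' = ∀ j i → Box n lam j i → T j i ≡ T' j i

InS : ℕ → (ℕ → ℕ) → (ℕ → ℕ) → Tab → Set
InS n lam β T = IsTableau n lam T × (∀ j i → Box n lam j i → T j i ≤ β i)

-- Q is a least upper bound of the set P ⊆ 𝒯_λ, in 𝒯_λ
-- (so Q_λ(β) is any Q with IsLUB n lam (InS n lam β) Q; unique up to ≈T)
IsLUB : ℕ → (ℕ → ℕ) → (Tab → Set) → Tab → Set
IsLUB n lam P Q =
  IsTableau n lam Q ×
  (∀ T → P T → T ≤T[ n , lam ] Q) ×
  (∀ U → IsTableau n lam U → (∀ T → P T → T ≤T[ n , lam ] U) → Q ≤T[ n , lam ] U)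

MSet : ℕ → (ℕ → ℕ) → (ℕ → ℕ) → Tab → Set
MSet n lam α T =
  IsTableau n lam T × (∀ i → 1 ≤ i → i ≤ n → 1 ≤ lam i → T (lam i) i ≡ α i)

-- M is a maximum element of P (so M_λ(α) is any M with IsMax (MSet α) M)
IsMax : ℕ → (ℕ → ℕ) → (Tab → Set) → Tab → Set
IsMax n lam P M = P M × (∀ T → P T → T ≤T[ n , lam ] M)

module Submission where

-- Proposition 12.4.  For β ∈ U_λ(n) put, for every box (j , i) of λ,
--     Q_j(i) = min { β_k − (k − i) : i ≤ k ≤ ζ_j } .
-- The bound T_j(i) + (k − i) ≤ T_j(k) ≤ β_k, valid down every column of a
-- tableau T ∈ 𝒮_λ(β), shows T ≤ Q, while Q itself is a tableau in 𝒮_λ(β).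
-- So 𝒮_λ(β) is the principal down-set [Q] of 𝒯_λ, and Q = Q_λ(β).
-- For (ii) we show that the core is the same kind of minimum taken over the
-- carrel of i,  Δ_λ(β)_i = min { β_k − (k − i) : i ≤ k ≤ q_h } , by
-- analysing the chain of critical indices; as the carrel of a row i with
-- λ_i ≥ 1 ends at ζ_{λ_i}, the last entries Q_{λ_i}(i) are exactly Δ_λ(β)_i,
-- and every T with these last entries lies in 𝒮_λ(β), so Q = M_λ(δ).

open import Defs
open import Data.Nat
open import Data.Nat.Properties
open import Data.Bool using (Bool; true; false; if_then_else_; _∨_; T)
open import Data.Bool.Properties using (T-≡; ¬-not; ∧-zeroʳ)
open import Data.Maybe using (just; nothing)
open import Data.Product using (_×_; Σ; _,_; proj₁; proj₂)
open import Data.Sum using (inj₁; inj₂)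
open import Data.Empty using (⊥-elim)
open import Relation.Nullary using (¬_; yes; no)
open import Relation.Binary.PropositionalEquality
open import Data.Nat.Tactic.RingSolver using (solve-∀)
open import Function.Bundles using (_⇔_; mk⇔; Equivalence)

open Equivalence using (to; from)

T⇒true : ∀ {b} → T b → b ≡ true
T⇒true = to T-≡

true⇒T : ∀ {b} → b ≡ true → T b
true⇒T = from T-≡

true≢false : true ≢ false
true≢false ()

firstIn-≥ : ∀ p a k → a ≤ firstIn p a k
firstIn-≥ p a zero = ≤-refl
firstIn-≥ p a (suc k) with p a
... | true = ≤-refl
... | false = ≤-trans (n≤1+n a) (firstIn-≥ p (suc a) k)

firstIn-≤ : ∀ p a k → firstIn p a k ≤ a + k
firstIn-≤ p a zero = m≤m+n a 0
firstIn-≤ p a (suc k) with p a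
... | true = m≤m+n a (suc k)
... | false = subst (firstIn p (suc a) k ≤_) (sym (+-suc a k)) (firstIn-≤ p (suc a) k)

firstIn-skips : ∀ p a k w → a ≤ w → w < firstIn p a k → p w ≡ false
firstIn-skips p a zero w a≤w w< = ⊥-elim (<⇒≱ w< a≤w)
firstIn-skips p a (suc k) w a≤w w< with p a in e
... | true = ⊥-elim (<⇒≱ w< a≤w)
... | false with m≤n⇒m<n∨m≡n a≤w
...   | inj₁ a<w = firstIn-skips p (suc a) k w a<w w<
...   | inj₂ refl = e

firstIn-hits : ∀ p a k → firstIn p a k < a + k → p (firstIn p a k) ≡ true
firstIn-hits p a zero lt = ⊥-elim (<⇒≱ lt (≤-reflexive (+-identityʳ a)))
firstIn-hits p a (suc k) lt with p a in e
... | true = e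
... | false = firstIn-hits p (suc a) k (subst (firstIn p (suc a) k <_) (+-suc a k) lt)

firstIn-unique : ∀ p a k r → a ≤ r → r ≤ a + k →
  (∀ w → a ≤ w → w < r → p w ≡ false) → (r < a + k → p r ≡ true) → firstIn p a k ≡ r
firstIn-unique p a zero r a≤r r≤ _ _ = ≤-antisym a≤r (subst (r ≤_) (+-identityʳ a) r≤)
firstIn-unique p a (suc k) r a≤r r≤ skip hit with p a in e | m≤n⇒m<n∨m≡n a≤r
... | true  | inj₁ a<r = ⊥-elim (true≢false (trans (sym e) (skip a ≤-refl a<r)))
... | true  | inj₂ a≡r = a≡r
... | false | inj₁ a<r = firstIn-unique p (suc a) k r a<r (subst (r ≤_) (+-suc a k) r≤)
                           (λ w sa≤w w<r → skip w (≤-trans (n≤1+n a) sa≤w) w<r)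
                           (λ lt → hit (subst (r <_) (sym (+-suc a k)) lt))
... | false | inj₂ refl = ⊥-elim (true≢false (trans (sym (hit (m<m+n a z<s))) e))

lastUpTo-≤ : ∀ p y → lastUpTo p y ≤ y
lastUpTo-≤ p zero = ≤-refl
lastUpTo-≤ p (suc y) with p (suc y)
... | true = ≤-refl
... | false = ≤-trans (lastUpTo-≤ p y) (n≤1+n y)

anyIn-true : ∀ p m j → 1 ≤ j → j ≤ m → p j ≡ true → anyIn p m ≡ true
anyIn-true p zero j 1≤j j≤m e = ⊥-elim (<⇒≱ 1≤j j≤m)
anyIn-true p (suc m) j 1≤j j≤m e with m≤n⇒m<n∨m≡n j≤m
... | inj₂ refl rewrite e = refl
... | inj₁ j<sm rewrite anyIn-true p m j 1≤j (≤-pred j<sm) e with p (suc m)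
...   | true = refl
...   | false = refl

anyIn-false : ∀ p m → (∀ j → 1 ≤ j → j ≤ m → p j ≡ false) → anyIn p m ≡ false
anyIn-false p zero _ = refl
anyIn-false p (suc m) none rewrite none (suc m) (s≤s z≤n) ≤-refl =
  anyIn-false p m (λ j a b → none j a (≤-trans b (n≤1+n m)))

count-≤ : ∀ p m → count p m ≤ m
count-≤ p zero = z≤n
count-≤ p (suc m) with p (suc m)
... | true = s≤s (count-≤ p m)
... | false = ≤-trans (count-≤ p m) (n≤1+n m)

count-mono : ∀ p {a} m → a ≤ m → count p a ≤ count p m
count-mono p zero z≤n = ≤-refl
count-mono p (suc m) a≤ with m≤n⇒m<n∨m≡n a≤
... | inj₂ refl = ≤-refl
... | inj₁ a<sm = ≤-trans (count-mono p m (≤-pred a<sm)) (m≤n+m (count p m) _)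

count-all : ∀ p m → (∀ k → 1 ≤ k → k ≤ m → p k ≡ true) → count p m ≡ m
count-all p zero _ = refl
count-all p (suc m) all rewrite all (suc m) (s≤s z≤n) ≤-refl =
  cong suc (count-all p m (λ k a b → all k a (≤-trans b (n≤1+n m))))

count-prefix : ∀ p i m → i ≤ m → (∀ k → 1 ≤ k → k ≤ i → p k ≡ true) → i ≤ count p m
count-prefix p i m i≤m all = subst (_≤ count p m) (count-all p i all) (count-mono p m i≤m)

count-suffix : ∀ p a m → a ≤ m → (∀ k → a < k → k ≤ m → p k ≡ false) → count p m ≤ a
count-suffix p a zero a≤ _ = z≤n
count-suffix p a (suc m) a≤ none with m≤n⇒m<n∨m≡n a≤
... | inj₂ refl = count-≤ p (suc m)
... | inj₁ a<sm rewrite none (suc m) a<sm ≤-refl =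
  count-suffix p a m (≤-pred a<sm) (λ k x y → none k x (≤-trans y (n≤1+n m)))

count-implies : ∀ p q m → (∀ k → p k ≡ true → q k ≡ true) → count p m ≤ count q m
count-implies p q zero _ = z≤n
count-implies p q (suc m) p⇒q with p (suc m) in e
... | true rewrite p⇒q (suc m) e = s≤s (count-implies p q m p⇒q)
... | false = ≤-trans (count-implies p q m p⇒q) (m≤n+m (count q m) _)

searchDown-nothing : ∀ p lo y → searchDown p lo y ≡ nothing →
  ∀ w → lo < w → w ≤ y → p w ≡ false
searchDown-nothing p lo zero _ w lo<w w≤y = ⊥-elim (<⇒≱ (≤-<-trans z≤n lo<w) w≤y)
searchDown-nothing p lo (suc y) e w lo<w w≤y with lo <ᵇ suc y in e₁
... | false = ⊥-elim (true≢false (trans (sym (T⇒true (<⇒<ᵇ (<-≤-trans lo<w w≤y)))) e₁))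
... | true with p (suc y) in e₂ | e
...   | true | ()
...   | false | e′ with m≤n⇒m<n∨m≡n w≤y
...     | inj₂ refl = e₂
...     | inj₁ w<sy = searchDown-nothing p lo y e′ w lo<w (≤-pred w<sy)

searchDown-just : ∀ p lo y z → searchDown p lo y ≡ just z →
  (lo < z) × (z ≤ y) × (p z ≡ true) × (∀ w → z < w → w ≤ y → p w ≡ false)
searchDown-just p lo zero z ()
searchDown-just p lo (suc y) z e with lo <ᵇ suc y in e₁
... | false with e
...   | ()
searchDown-just p lo (suc y) z e | true with p (suc y) in e₂
...   | true with e
...     | refl = <ᵇ⇒< lo (suc y) (true⇒T e₁) , ≤-refl , e₂ , (λ w z<w w≤z → ⊥-elim (<⇒≱ z<w w≤z))
searchDown-just p lo (suc y) z e | true | false with searchDown-just p lo y z e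
...     | lo<z , z≤y , hit , miss = lo<z , m≤n⇒m≤1+n z≤y , hit , miss′
  where
  miss′ : ∀ w → z < w → w ≤ suc y → p w ≡ false
  miss′ w z<w w≤sy with m≤n⇒m<n∨m≡n w≤sy
  ... | inj₁ w<sy = miss w z<w (≤-pred w<sy)
  ... | inj₂ refl = e₂

-- Rise< β x k  (resp. Rise≤): for x < k, β climbs from x to k by more than
-- (resp. at least) k − x; written additively to stay in ℕ.
Rise< : (ℕ → ℕ) → ℕ → ℕ → Set
Rise< β x k = β x + k < β k + x

Rise≤ : (ℕ → ℕ) → ℕ → ℕ → Set
Rise≤ β x k = β x + k ≤ β k + x

-- rearrangements letting the middle term β y + y cancel when two rises are added
swap₂ : ∀ p q r s → (p + q) + (r + s) ≡ (p + s) + (r + q)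
swap₂ = solve-∀

swap₁ : ∀ p q r s → (p + q) + (r + s) ≡ (r + q) + (p + s)
swap₁ = solve-∀

Rise<-trans : ∀ β {x y z} → Rise< β x y → Rise< β y z → Rise< β x z
Rise<-trans β {x} {y} {z} xy yz = +-cancelʳ-< (β y + y) (β x + z) (β z + x)
  (subst₂ _<_ (swap₂ (β x) y (β y) z) (swap₁ (β y) x (β z) y) (+-mono-< xy yz))

Rise<-≤-trans : ∀ β {x y z} → Rise< β x y → Rise≤ β y z → Rise< β x z
Rise<-≤-trans β {x} {y} {z} xy yz = +-cancelʳ-< (β y + y) (β x + z) (β z + x)
  (subst₂ _<_ (swap₂ (β x) y (β y) z) (swap₁ (β y) x (β z) y) (+-mono-<-≤ xy yz))

-- The chain of critical indices walked by critFrom consists exactly of the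
-- indices from which β rises strictly to every later index up to the start.
module Critical (β : ℕ → ℕ) where

  nextCrit-just : ∀ lo y z → nextCrit β lo y ≡ just z →
    (lo < z) × (z < y) × Rise< β z y × (∀ w → z < w → w < y → ¬ Rise< β w y)
  nextCrit-just lo y z e with searchDown-just _ lo (y ∸ 1) z e
  ... | lo<z , z≤y-1 , hit , miss =
        lo<z , below y z≤y-1 , <ᵇ⇒< _ _ (true⇒T hit) ,
        (λ w z<w w<y r → true≢false (trans (sym (T⇒true (<⇒<ᵇ r))) (miss w z<w (<⇒≤pred w<y))))
    where
    below : ∀ y → z ≤ y ∸ 1 → z < y
    below zero z≤0 = ⊥-elim (<⇒≱ (≤-<-trans z≤n lo<z) z≤0)
    below (suc y) z≤y = s≤s z≤y

  nextCrit-nothing : ∀ lo y → nextCrit β lo y ≡ nothing →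
    ∀ w → lo < w → w < y → ¬ Rise< β w y
  nextCrit-nothing lo y e w lo<w w<y r =
    true≢false (trans (sym (T⇒true (<⇒<ᵇ r))) (searchDown-nothing _ lo (y ∸ 1) e w lo<w (<⇒≤pred w<y)))

  critFrom-above : ∀ f lo y x → y < x → critFrom β f lo y x ≡ false
  critFrom-above zero lo y x y<x = ¬-not (λ e → <-irrefl (sym (≡ᵇ⇒≡ x y (true⇒T e))) y<x)
  critFrom-above (suc f) lo y x y<x with x ≡ᵇ y in e
  ... | true = ⊥-elim (<-irrefl (sym (≡ᵇ⇒≡ x y (true⇒T e))) y<x)
  ... | false with nextCrit β lo y in e₂
  ...   | nothing = refl
  ...   | just z = critFrom-above f lo z x (<-trans (proj₁ (proj₂ (nextCrit-just lo y z e₂))) y<x)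

  critFrom⇒rises : ∀ f lo y x → x ≤ y → critFrom β f lo y x ≡ true →
    ∀ k → x < k → k ≤ y → Rise< β x k
  critFrom⇒rises zero lo y x x≤y c k x<k k≤y with ≡ᵇ⇒≡ x y (true⇒T c)
  ... | refl = ⊥-elim (<⇒≱ x<k k≤y)
  critFrom⇒rises (suc f) lo y x x≤y c k x<k k≤y with x ≡ᵇ y in e
  ... | true with ≡ᵇ⇒≡ x y (true⇒T e)
  ...   | refl = ⊥-elim (<⇒≱ x<k k≤y)
  critFrom⇒rises (suc f) lo y x x≤y c k x<k k≤y | false with nextCrit β lo y in e₂
  ...   | nothing with c
  ...     | ()
  critFrom⇒rises (suc f) lo y x x≤y c k x<k k≤y | false | just z
    with nextCrit-just lo y z e₂ | z <? x
  ...   | _ | yes z<x = ⊥-elim (true≢false (trans (sym c) (critFrom-above f lo z x z<x)))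
  ...   | _ , _ , z↑y , gap | no z≮x = rises
    where
    x≤z = ≮⇒≥ z≮x
    ih = critFrom⇒rises f lo z x x≤z c
    x↑y : Rise< β x y
    x↑y with m≤n⇒m<n∨m≡n x≤z
    ... | inj₁ x<z = Rise<-trans β (ih z x<z ≤-refl) z↑y
    ... | inj₂ refl = z↑y
    rises : Rise< β x k
    rises with k ≤? z | m≤n⇒m<n∨m≡n k≤y
    ... | yes k≤z | _ = ih k x<k k≤z
    ... | no _ | inj₂ refl = x↑y
    ... | no k≰z | inj₁ k<y = Rise<-≤-trans β x↑y (≮⇒≥ (gap k (≰⇒> k≰z) k<y))

  rises⇒critFrom : ∀ f lo y x → lo < x → x ≤ y → y ∸ x ≤ f →
    (∀ k → x < k → k ≤ y → Rise< β x k) → critFrom β f lo y x ≡ true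
  rises⇒critFrom zero lo y x _ x≤y d _ =
    T⇒true (≡⇒≡ᵇ x y (≤-antisym x≤y (m∸n≡0⇒m≤n (n≤0⇒n≡0 d))))
  rises⇒critFrom (suc f) lo y x lo<x x≤y d rises with x ≡ᵇ y in e
  ... | true = refl
  ... | false with m≤n⇒m<n∨m≡n x≤y
  ...   | inj₂ x≡y = ⊥-elim (true≢false (trans (sym (T⇒true (≡⇒≡ᵇ x y x≡y))) e))
  ...   | inj₁ x<y with nextCrit β lo y in e₂
  ...     | nothing = ⊥-elim (nextCrit-nothing lo y e₂ x lo<x x<y (rises y x<y ≤-refl))
  ...     | just z with nextCrit-just lo y z e₂ | z <? x
  ...       | _ , _ , _ , gap | yes z<x = ⊥-elim (gap x z<x x<y (rises y x<y ≤-refl))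
  ...       | _ , z<y , _ , _ | no z≮x =
    rises⇒critFrom f lo z x lo<x (≮⇒≥ z≮x) d′ (λ k x<k k≤z → rises k x<k (≤-trans k≤z (<⇒≤ z<y)))
    where
    d′ : z ∸ x ≤ f
    d′ = ≤-trans (∸-monoˡ-≤ x (<⇒≤pred z<y))
           (≤-trans (≤-reflexive (trans (∸-+-assoc y 1 x) (sym (pred[m∸n]≡m∸[1+n] y x))))
              (pred-mono-≤ d))

module Shape (n : ℕ) (lam : ℕ → ℕ) (P : IsPartition n lam) where

  lam-anti : ∀ a b → 1 ≤ a → a ≤ b → b ≤ n → lam b ≤ lam a
  lam-anti a b 1≤a a≤b b≤n = subst (λ c → lam c ≤ lam a) (m+[n∸m]≡n a≤b)
      (steps (b ∸ a) (subst (_≤ n) (sym (m+[n∸m]≡n a≤b)) b≤n))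
    where
    steps : ∀ d → a + d ≤ n → lam (a + d) ≤ lam a
    steps zero _ rewrite +-identityʳ a = ≤-refl
    steps (suc d) le rewrite +-suc a d =
      ≤-trans (P (a + d) (≤-trans 1≤a (m≤m+n a d)) le) (steps d (≤-trans (n≤1+n _) le))

  colLen : ℕ → ℕ
  colLen j = ζ n lam j

  colLen-≤ : ∀ j → colLen j ≤ n
  colLen-≤ j = count-≤ _ n

  colLen-anti : ∀ j j' → j ≤ j' → colLen j' ≤ colLen j
  colLen-anti j j' j≤j' = count-implies _ _ n
    (λ k e → T⇒true (≤⇒≤ᵇ (≤-trans j≤j' (≤ᵇ⇒≤ j' (lam k) (true⇒T e)))))

  colLen-≥ : ∀ i j → 1 ≤ i → i ≤ n → j ≤ lam i → i ≤ colLen j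
  colLen-≥ i j 1≤i i≤n j≤λi = count-prefix _ i n i≤n
    (λ k 1≤k k≤i → T⇒true (≤⇒≤ᵇ (≤-trans j≤λi (lam-anti k i 1≤k k≤i i≤n))))

  colLen-< : ∀ w j → 1 ≤ w → w ≤ n → lam w < j → colLen j < w
  colLen-< (suc w) j 1≤w w≤n λw<j = s≤s (count-suffix _ w n (≤-trans (n≤1+n w) w≤n)
    (λ k w<k k≤n → ¬-not (λ e → <⇒≱ λw<j
       (≤-trans (≤ᵇ⇒≤ j (lam k) (true⇒T e)) (lam-anti (suc w) k 1≤w w<k k≤n)))))

  inColumn : ∀ w j → 1 ≤ w → w ≤ n → w ≤ colLen j → j ≤ lam w
  inColumn w j 1≤w w≤n w≤ζ with j ≤? lam w
  ... | yes j≤λw = j≤λw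
  ... | no j≰λw = ⊥-elim (<⇒≱ (colLen-< w j 1≤w w≤n (≰⇒> j≰λw)) w≤ζ)

  box : ∀ j w → 1 ≤ j → 1 ≤ w → w ≤ colLen j → Box n lam j w
  box j w 1≤j 1≤w w≤ζ = (1≤w , w≤n) , (1≤j , inColumn w j 1≤w w≤n w≤ζ)
    where w≤n = ≤-trans w≤ζ (colLen-≤ j)

  box-in-column : ∀ {j i} → Box n lam j i → i ≤ colLen j
  box-in-column {j} {i} ((1≤i , i≤n) , (_ , j≤λi)) = colLen-≥ i j 1≤i i≤n j≤λi

  column-gap : ∀ T → IsTableau n lam T → ∀ {j i k} → Box n lam j i → i ≤ k → k ≤ colLen j →
    T j i + (k ∸ i) ≤ T j k
  column-gap T (_ , strict , _) {j} {i} {k} b@((1≤i , _) , (1≤j , _)) i≤k k≤ζ =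
    subst (λ x → T j i + (k ∸ i) ≤ T j x) (m+[n∸m]≡n i≤k)
      (steps (k ∸ i) (subst (_≤ colLen j) (sym (m+[n∸m]≡n i≤k)) k≤ζ))
    where
    steps : ∀ d → i + d ≤ colLen j → T j i + d ≤ T j (i + d)
    steps zero _ rewrite +-identityʳ i | +-identityʳ (T j i) = ≤-refl
    steps (suc d) le rewrite +-suc i d | +-suc (T j i) d =
      ≤-trans (s≤s (steps d (≤-trans (n≤1+n _) le)))
        (strict j (i + d) (box j (i + d) 1≤j (≤-trans 1≤i (m≤m+n i d)) (≤-trans (n≤1+n _) le))
                          (box j (suc (i + d)) 1≤j (s≤s z≤n) le))

  row-mono : ∀ T → IsTableau n lam T → ∀ {j i j'} → Box n lam j i → j ≤ j' → j' ≤ lam i →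
    T j i ≤ T j' i
  row-mono T (_ , _ , weak) {j} {i} {j'} (rowOK , (1≤j , _)) j≤j' j'≤λi =
    subst (λ x → T j i ≤ T x i) (m+[n∸m]≡n j≤j')
      (steps (j' ∸ j) (subst (_≤ lam i) (sym (m+[n∸m]≡n j≤j')) j'≤λi))
    where
    steps : ∀ d → j + d ≤ lam i → T j i ≤ T (j + d) i
    steps zero _ rewrite +-identityʳ j = ≤-refl
    steps (suc d) le rewrite +-suc j d =
      ≤-trans (steps d (≤-trans (n≤1+n _) le))
        (weak (j + d) i (rowOK , (≤-trans 1≤j (m≤m+n j d) , ≤-trans (n≤1+n _) le)) (rowOK , (s≤s z≤n , le)))

  isEnd : ℕ → Bool
  isEnd q = inR n lam q ∨ (q ≡ᵇ n)

  top : ℕ → ℕ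
  top x = carrelTop n lam x

  top-≥ : ∀ x → x ≤ top x
  top-≥ x = firstIn-≥ isEnd x (n ∸ x)

  top-≤ : ∀ x → x ≤ n → top x ≤ n
  top-≤ x x≤n = subst (top x ≤_) (m+[n∸m]≡n x≤n) (firstIn-≤ isEnd x (n ∸ x))

  top-same : ∀ x y → x ≤ n → x ≤ y → y ≤ top x → top y ≡ top x
  top-same x y x≤n x≤y y≤t = firstIn-unique isEnd y (n ∸ y) (top x) y≤t
      (subst (top x ≤_) (sym (m+[n∸m]≡n y≤n)) t≤n)
      (λ w y≤w w<t → firstIn-skips isEnd x (n ∸ x) w (≤-trans x≤y y≤w) w<t)
      (λ t<y+ → firstIn-hits isEnd x (n ∸ x)
        (subst (top x <_) (sym (m+[n∸m]≡n x≤n)) (subst (top x <_) (m+[n∸m]≡n y≤n) t<y+)))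
    where
    t≤n = top-≤ x x≤n
    y≤n = ≤-trans y≤t t≤n

  bot< : ∀ x → 1 ≤ x → carrelBot n lam x < x
  bot< (suc x) _ = s≤s (lastUpTo-≤ _ x)

  noColumnEnds : ∀ i → 1 ≤ i → i ≤ n → ∀ w → i ≤ w → w < colLen (lam i) →
    ∀ j → 1 ≤ j → j ≤ lam 1 → (colLen j ≡ᵇ w) ≡ false
  noColumnEnds i 1≤i i≤n w i≤w w<ζ j _ _ = ¬-not (λ e → ends (≡ᵇ⇒≡ (colLen j) w (true⇒T e)))
    where
    ends : colLen j ≢ w
    ends ζj≡w with j ≤? lam i
    ... | yes j≤λi = <⇒≱ w<ζ (subst (colLen (lam i) ≤_) ζj≡w (colLen-anti j (lam i) j≤λi))
    ... | no j≰λi = <⇒≱ (colLen-< i j 1≤i i≤n (≰⇒> j≰λi)) (subst (i ≤_) (sym ζj≡w) i≤w)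

  top-row : ∀ i → 1 ≤ i → i ≤ n → 1 ≤ lam i → top i ≡ colLen (lam i)
  top-row i 1≤i i≤n 1≤λi = firstIn-unique isEnd i (n ∸ i) ζλ
      (colLen-≥ i (lam i) 1≤i i≤n ≤-refl)
      (subst (ζλ ≤_) (sym (m+[n∸m]≡n i≤n)) (colLen-≤ (lam i)))
      notEnd isEnd-ζ
    where
    ζλ = colLen (lam i)
    notEnd : ∀ w → i ≤ w → w < ζλ → isEnd w ≡ false
    notEnd w i≤w w<ζ
      rewrite anyIn-false (λ j → colLen j ≡ᵇ w) (lam 1) (noColumnEnds i 1≤i i≤n w i≤w w<ζ)
            | ∧-zeroʳ (w <ᵇ n) =
      ¬-not (λ e → <-irrefl (≡ᵇ⇒≡ w n (true⇒T e)) (<-≤-trans w<ζ (colLen-≤ (lam i))))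
    isEnd-ζ : ζλ < i + (n ∸ i) → isEnd ζλ ≡ true
    isEnd-ζ ζ<
      rewrite T⇒true (<⇒<ᵇ (subst (ζλ <_) (m+[n∸m]≡n i≤n) ζ<))
            | anyIn-true (λ j → colLen j ≡ᵇ ζλ) (lam 1) (lam i) 1≤λi
                (lam-anti 1 i ≤-refl 1≤i i≤n) (T⇒true (≡⇒≡ᵇ ζλ ζλ refl)) = refl

-- shift β i k = β_k − (k − i): if an entry in row k ≥ i of a column is at
-- most β_k, the entry in row i of that column is at most shift β i k
shift : (ℕ → ℕ) → ℕ → ℕ → ℕ
shift β i k = (β k + i) ∸ k

shift-self : ∀ β i → shift β i i ≡ β i
shift-self β i = m+n∸n≡m (β i) i

shift-≡ : ∀ β i k → i ≤ k → k ≤ β k → β k ∸ (k ∸ i) ≡ shift β i k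
shift-≡ β i k i≤k k≤βk = begin
  β k ∸ (k ∸ i)               ≡⟨ sym ([m+n]∸[m+o]≡n∸o i (β k) (k ∸ i)) ⟩
  (i + β k) ∸ (i + (k ∸ i))   ≡⟨ cong₂ _∸_ (+-comm i (β k)) (m+[n∸m]≡n i≤k) ⟩
  (β k + i) ∸ k               ∎
  where open ≡-Reasoning

shift-≥ : ∀ β i k → k ≤ β k → i ≤ shift β i k
shift-≥ β i k k≤βk = subst (i ≤_) (sym (+-∸-comm i k≤βk)) (m≤n+m i (β k ∸ k))

shift-≤ : ∀ β i k → i ≤ k → shift β i k ≤ β k
shift-≤ β i k i≤k = subst (shift β i k ≤_) (m+n∸n≡m (β k) k) (∸-monoˡ-≤ k (+-monoʳ-≤ (β k) i≤k))

shift-suc : ∀ β i k → k ≤ β k → shift β (suc i) k ≡ suc (shift β i k)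
shift-suc β i k k≤βk =
  trans (+-∸-comm (suc i) k≤βk) (trans (+-suc (β k ∸ k) i) (cong suc (sym (+-∸-comm i k≤βk))))

swap-last : ∀ a b c → a + b + c ≡ a + c + b
swap-last = solve-∀

shift-rise : ∀ β i x k → Rise≤ β x k → x ≤ β x → shift β i x ≤ shift β i k
shift-rise β i x k rise x≤βx = m+n≤o⇒m≤o∸n (shift β i x) (+-cancelʳ-≤ x _ _ (begin
    shift β i x + k + x    ≡⟨ swap-last (shift β i x) k x ⟩
    shift β i x + x + k    ≡⟨ cong (_+ k) (m∸n+n≡m (≤-trans x≤βx (m≤m+n (β x) i))) ⟩
    β x + i + k            ≡⟨ swap-last (β x) i k ⟩
    β x + k + i            ≤⟨ +-monoˡ-≤ i rise ⟩
    β k + x + i            ≡⟨ swap-last (β k) x i ⟩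
    β k + i + x            ∎))
  where open ≤-Reasoning

IsMinOver : (ℕ → ℕ) → ℕ → ℕ → ℕ → Set
IsMinOver f a b v = (Σ ℕ λ k → a ≤ k × k ≤ b × v ≡ f k) × (∀ k → a ≤ k → k ≤ b → v ≤ f k)

minOver-unique : ∀ {f a b v v'} → IsMinOver f a b v → IsMinOver f a b v' → v ≡ v'
minOver-unique ((k , a≤k , k≤b , v≡) , lb) ((k' , a≤k' , k'≤b , v'≡) , lb') =
  ≤-antisym (subst (_ ≤_) (sym v'≡) (lb k' a≤k' k'≤b)) (subst (_ ≤_) (sym v≡) (lb' k a≤k k≤b))

minOver-shrink : ∀ {f a b b' v v'} → b' ≤ b → IsMinOver f a b v → IsMinOver f a b' v' → v ≤ v'
minOver-shrink b'≤b (_ , lb) ((k , a≤k , k≤b' , v'≡) , _) =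
  subst (_ ≤_) (sym v'≡) (lb k a≤k (≤-trans k≤b' b'≤b))

minFrom : (ℕ → ℕ) → ℕ → ℕ → ℕ
minFrom f a zero = f a
minFrom f a (suc d) = f a ⊓ minFrom f (suc a) d

minFrom-isMin : ∀ f a d → IsMinOver f a (a + d) (minFrom f a d)
minFrom-isMin f a d = attained a d , lower a d
  where
  attained : ∀ a d → Σ ℕ λ k → a ≤ k × k ≤ a + d × minFrom f a d ≡ f k
  attained a zero = a , ≤-refl , m≤m+n a 0 , refl
  attained a (suc d) with ⊓-sel (f a) (minFrom f (suc a) d) | attained (suc a) d
  ... | inj₁ here | _ = a , ≤-refl , m≤m+n a (suc d) , here
  ... | inj₂ there | k , sa≤k , k≤ , eq =
    k , ≤-trans (n≤1+n a) sa≤k , subst (k ≤_) (sym (+-suc a d)) k≤ , trans there eq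
  lower : ∀ a d k → a ≤ k → k ≤ a + d → minFrom f a d ≤ f k
  lower a zero k a≤k k≤ with ≤-antisym a≤k (subst (k ≤_) (+-identityʳ a) k≤)
  ... | refl = ≤-refl
  lower a (suc d) k a≤k k≤ with m≤n⇒m<n∨m≡n a≤k
  ... | inj₂ refl = m⊓n≤m _ _
  ... | inj₁ a<k = ≤-trans (m⊓n≤n _ _) (lower (suc a) d k a<k (subst (k ≤_) (+-suc a d) k≤))

module ShiftedMinima (n : ℕ) (β : ℕ → ℕ) (upper : ∀ k → 1 ≤ k → k ≤ n → k ≤ β k)
                     (bounded : ∀ k → 1 ≤ k → k ≤ n → β k ≤ n) where

  shiftMin-range : ∀ {i b v} → 1 ≤ i → b ≤ n → IsMinOver (shift β i) i b v → i ≤ v × v ≤ n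
  shiftMin-range {i} 1≤i b≤n ((k , i≤k , k≤b , v≡) , _) =
    subst (i ≤_) (sym v≡) (shift-≥ β i k (upper k 1≤k k≤n)) ,
    subst (_≤ n) (sym v≡) (≤-trans (shift-≤ β i k i≤k) (bounded k 1≤k k≤n))
    where
    1≤k = ≤-trans 1≤i i≤k
    k≤n = ≤-trans k≤b b≤n

  shiftMin-step : ∀ {i b v v'} → b ≤ n →
    IsMinOver (shift β i) i b v → IsMinOver (shift β (suc i)) (suc i) b v' → v < v'
  shiftMin-step {i} b≤n (_ , lb) ((k , si≤k , k≤b , v'≡) , _) =
    subst (_ <_) (sym (trans v'≡ (shift-suc β i k k≤βk)))
      (s≤s (lb k (≤-trans (n≤1+n i) si≤k) k≤b))
    where
    k≤βk = upper k (≤-trans (s≤s z≤n) si≤k) (≤-trans k≤b b≤n)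

module Order (n : ℕ) (lam : ℕ → ℕ) where

  _⊑_ : Tab → Tab → Set
  A ⊑ B = A ≤T[ n , lam ] B

  _≈_ : Tab → Tab → Set
  A ≈ B = A ≈T[ n , lam ] B

  ⊑-refl : ∀ {A} → A ⊑ A
  ⊑-refl _ _ _ = ≤-refl

  ⊑-trans : ∀ {A B C} → A ⊑ B → B ⊑ C → A ⊑ C
  ⊑-trans A⊑B B⊑C j i b = ≤-trans (A⊑B j i b) (B⊑C j i b)

  ⊑-antisym : ∀ {A B} → A ⊑ B → B ⊑ A → A ≈ B
  ⊑-antisym A⊑B B⊑A j i b = ≤-antisym (A⊑B j i b) (B⊑A j i b)

  ≈⇒⊑ : ∀ {A B} → A ≈ B → A ⊑ B
  ≈⇒⊑ A≈B j i b = ≤-reflexive (A≈B j i b)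

  ≈-refl : ∀ {A} → A ≈ A
  ≈-refl _ _ _ = refl

  ≈-sym : ∀ {A B} → A ≈ B → B ≈ A
  ≈-sym A≈B j i b = sym (A≈B j i b)

  IsPrincipal : (Tab → Set) → Tab → Set
  IsPrincipal P G = IsTableau n lam G × (∀ T → P T ⇔ (IsTableau n lam T × T ⊑ G))

  principal-lub : ∀ {P G} → IsPrincipal P G → IsLUB n lam P G
  principal-lub (tG , [G]) =
    tG , (λ T p → proj₂ (to ([G] T) p)) , (λ U _ ub → ub _ (from ([G] _) (tG , ⊑-refl)))

  lub-unique : ∀ {P A B} → IsLUB n lam P A → IsLUB n lam P B → A ≈ B
  lub-unique (tA , ubA , leastA) (tB , ubB , leastB) =
    ⊑-antisym (leastA _ tB ubB) (leastB _ tA ubA)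

  max-unique : ∀ {P A B} → IsMax n lam P A → IsMax n lam P B → A ≈ B
  max-unique (pA , maxA) (pB , maxB) = ⊑-antisym (maxB _ pA) (maxA _ pB)

  principal-resp-≈ : ∀ {P A B} → IsPrincipal P A → IsTableau n lam B → A ≈ B → IsPrincipal P B
  principal-resp-≈ (_ , [A]) tB A≈B = tB , λ T → mk⇔
    (λ p → proj₁ (to ([A] T) p) , ⊑-trans (proj₂ (to ([A] T) p)) (≈⇒⊑ A≈B))
    (λ { (tT , T⊑B) → from ([A] T) (tT , ⊑-trans T⊑B (≈⇒⊑ (≈-sym A≈B))) })

  principal-at-lub : ∀ {P G Q} → IsPrincipal P G → IsLUB n lam P Q → IsPrincipal P Q
  principal-at-lub [G] lubQ =
    principal-resp-≈ [G] (proj₁ lubQ) (lub-unique (principal-lub [G]) lubQ)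

  principal-ext : ∀ {P P' G G'} → IsPrincipal P G → IsPrincipal P' G' →
    (∀ T → P T ⇔ P' T) ⇔ G ≈ G'
  principal-ext {P} {P'} {G} {G'} (tG , [G]) (tG' , [G']) = mk⇔
    (λ same → ⊑-antisym {G} {G'} (generator-below {P} {P'} {G} {G'} [G] [G'] same tG)
                         (generator-below {P'} {P} {G'} {G} [G'] [G] (flip same) tG'))
    (λ G≈G' T → mk⇔
      (λ p → from ([G'] T) (proj₁ (to ([G] T) p) , ⊑-trans (proj₂ (to ([G] T) p)) (≈⇒⊑ G≈G')))
      (λ p → from ([G] T) (proj₁ (to ([G'] T) p) , ⊑-trans (proj₂ (to ([G'] T) p)) (≈⇒⊑ (≈-sym G≈G')))))
    where
    flip : (∀ T → P T ⇔ P' T) → ∀ T → P' T ⇔ P T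
    flip same T = mk⇔ (from (same T)) (to (same T))
    generator-below : ∀ {R R' H H'} → (∀ T → R T ⇔ (IsTableau n lam T × T ⊑ H)) →
      (∀ T → R' T ⇔ (IsTableau n lam T × T ⊑ H')) → (∀ T → R T ⇔ R' T) →
      IsTableau n lam H → H ⊑ H'
    generator-below {H = H} [H] [H'] same tH =
      proj₂ (to ([H'] H) (to (same H) (from ([H] H) (tH , ⊑-refl))))

module Bounded (n : ℕ) (lam : ℕ → ℕ) (P : IsPartition n lam)
               (β : ℕ → ℕ) (U : InU n lam β) where
  open Shape n lam P
  open Order n lam
  open Critical β

  upper : ∀ k → 1 ≤ k → k ≤ n → k ≤ β k
  upper = proj₂ U

  bounded : ∀ k → 1 ≤ k → k ≤ n → β k ≤ n
  bounded k 1≤k k≤n = proj₂ (proj₁ U k 1≤k k≤n)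

  open ShiftedMinima n β upper bounded

  critical : ℕ → Bool
  critical = isCritical n lam β

  critical⇒rises : ∀ x → critical x ≡ true → ∀ k → x < k → k ≤ top x → Rise< β x k
  critical⇒rises x = critFrom⇒rises n (carrelBot n lam x) (top x) x (top-≥ x)

  rises⇒critical : ∀ x → 1 ≤ x → x ≤ n →
    (∀ k → x < k → k ≤ top x → Rise< β x k) → critical x ≡ true
  rises⇒critical x 1≤x x≤n = rises⇒critFrom n (carrelBot n lam x) (top x) x (bot< x 1≤x) (top-≥ x)
    (≤-trans (m∸n≤m (top x) x) (top-≤ x x≤n))

  end-critical : ∀ i → 1 ≤ i → i ≤ n → critical (top i) ≡ true
  end-critical i 1≤i i≤n = rises⇒critical (top i) (≤-trans 1≤i (top-≥ i)) (top-≤ i i≤n)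
    (λ k t<k k≤tt → ⊥-elim (<⇒≱ t<k (subst (k ≤_) (top-same i (top i) i≤n (top-≥ i) ≤-refl) k≤tt)))

  fromNextCritical : ℕ → ℕ
  fromNextCritical i = let x = nextCriticalAbove n lam β i in β x ∸ (x ∸ i)

  Δ-critical : ∀ i → critical i ≡ true → Δ n lam β i ≡ β i
  Δ-critical i c = cong (λ b → if b then β i else fromNextCritical i) c

  Δ-noncritical : ∀ i → critical i ≡ false → Δ n lam β i ≡ fromNextCritical i
  Δ-noncritical i c = cong (λ b → if b then β i else fromNextCritical i) c

  Δ-isMin-critical : ∀ i → critical i ≡ true → IsMinOver (shift β i) i (top i) (Δ n lam β i)
  Δ-isMin-critical i c rewrite Δ-critical i c =
    (i , ≤-refl , top-≥ i , sym (shift-self β i)) , lower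
    where
    lower : ∀ k → i ≤ k → k ≤ top i → β i ≤ shift β i k
    lower k i≤k k≤t with m≤n⇒m<n∨m≡n i≤k
    ... | inj₂ refl = ≤-reflexive (sym (shift-self β i))
    ... | inj₁ i<k = m+n≤o⇒m≤o∸n (β i) (<⇒≤ (critical⇒rises i c k i<k k≤t))

  -- Below a non-critical index i, the next critical index r of the carrel
  -- dominates every index of [i, q_h], which makes β_r − (r − i) the minimum.
  module NonCritical (i : ℕ) (1≤i : 1 ≤ i) (i≤n : i ≤ n) (noncrit : critical i ≡ false) where
    t = top i
    r = nextCriticalAbove n lam β i

    t≤n : t ≤ n
    t≤n = top-≤ i i≤n

    i<t : i < t
    i<t = ≤∧≢⇒< (top-≥ i) (λ i≡t → true≢false
      (trans (sym (end-critical i 1≤i i≤n)) (trans (cong critical (sym i≡t)) noncrit)))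

    i<r : i < r
    i<r = firstIn-≥ critical (suc i) (n ∸ suc i)

    r≤t : r ≤ t
    r≤t with t <? r
    ... | yes t<r = ⊥-elim (true≢false (trans (sym (end-critical i 1≤i i≤n))
                      (firstIn-skips critical (suc i) (n ∸ suc i) t i<t t<r)))
    ... | no t≮r = ≮⇒≥ t≮r

    1≤r = ≤-trans 1≤i (<⇒≤ i<r)
    r≤n = ≤-trans r≤t t≤n

    r-critical : critical r ≡ true
    r-critical with r <? n
    ... | yes r<n = firstIn-hits critical (suc i) (n ∸ suc i)
                      (subst (r <_) (sym (m+[n∸m]≡n (<-≤-trans i<t t≤n))) r<n)
    ... | no r≮n = subst (λ x → critical x ≡ true) (≤-antisym (≤-trans t≤n (≮⇒≥ r≮n)) r≤t)
                     (end-critical i 1≤i i≤n)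

    between-noncritical : ∀ w → i ≤ w → w < r → critical w ≡ false
    between-noncritical w i≤w w<r with m≤n⇒m<n∨m≡n i≤w
    ... | inj₂ refl = noncrit
    ... | inj₁ i<w = firstIn-skips critical (suc i) (n ∸ suc i) w i<w w<r

    same-carrel : ∀ w → i ≤ w → w ≤ t → top w ≡ t
    same-carrel w = top-same i w i≤n

    r-rises : ∀ k → r < k → k ≤ t → Rise< β r k
    r-rises k r<k k≤t = critical⇒rises r r-critical k r<k
      (subst (k ≤_) (sym (same-carrel r (<⇒≤ i<r) r≤t)) k≤t)

    -- if β rose strictly from some w ∈ [i, r) to r, w would be critical;
    -- by induction on the distance r − w
    r-below : ∀ d w → i ≤ w → w < r → r ∸ w ≤ d → Rise≤ β r w
    r-below zero w _ w<r d = ⊥-elim (<⇒≱ w<r (m∸n≡0⇒m≤n (n≤0⇒n≡0 d)))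
    r-below (suc d) w i≤w w<r dist with β r + w ≤? β w + r
    ... | yes r↓w = r↓w
    ... | no r↓̸w = ⊥-elim (true≢false (trans (sym w-critical) (between-noncritical w i≤w w<r)))
      where
      w↑r : Rise< β w r
      w↑r = ≰⇒> r↓̸w
      w-rises : ∀ k → w < k → k ≤ top w → Rise< β w k
      w-rises k w<k k≤tw with k <? r
      ... | yes k<r = Rise<-≤-trans β w↑r (r-below d k (≤-trans i≤w (<⇒≤ w<k)) k<r
                            (≤-pred (≤-trans (∸-monoʳ-< w<k (<⇒≤ k<r)) dist)))
      ... | no k≮r with m≤n⇒m<n∨m≡n (≮⇒≥ k≮r)
      ...   | inj₂ refl = w↑r
      ...   | inj₁ r<k = Rise<-trans β w↑r
                           (r-rises k r<k (subst (k ≤_) (same-carrel w i≤w (≤-trans (<⇒≤ w<r) r≤t)) k≤tw))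
      w-critical : critical w ≡ true
      w-critical = rises⇒critical w (≤-trans 1≤i i≤w) (≤-trans (<⇒≤ w<r) r≤n) w-rises

    r-dominates : ∀ k → i ≤ k → k ≤ t → Rise≤ β r k
    r-dominates k i≤k k≤t with k <? r
    ... | yes k<r = r-below r k i≤k k<r (m∸n≤m r k)
    ... | no k≮r with m≤n⇒m<n∨m≡n (≮⇒≥ k≮r)
    ...   | inj₂ refl = ≤-refl
    ...   | inj₁ r<k = <⇒≤ (r-rises k r<k k≤t)

    Δ-isMin-noncritical : IsMinOver (shift β i) i t (Δ n lam β i)
    Δ-isMin-noncritical rewrite Δ-noncritical i noncrit | shift-≡ β i r (<⇒≤ i<r) (upper r 1≤r r≤n) =
      (r , <⇒≤ i<r , r≤t , refl) ,
      (λ k i≤k k≤t → shift-rise β i r k (r-dominates k i≤k k≤t) (upper r 1≤r r≤n))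

  Δ-isMin : ∀ i → 1 ≤ i → i ≤ n → IsMinOver (shift β i) i (top i) (Δ n lam β i)
  Δ-isMin i 1≤i i≤n = by-criticality (critical i) refl
    where
    by-criticality : ∀ b → critical i ≡ b → IsMinOver (shift β i) i (top i) (Δ n lam β i)
    by-criticality true c = Δ-isMin-critical i c
    by-criticality false c = NonCritical.Δ-isMin-noncritical i 1≤i i≤n c

  Δ-inUI : InUI n lam (Δ n lam β)
  Δ-inUI = (entries , (λ i 1≤i i≤n → proj₁ (bounds i 1≤i i≤n))) , increasing
    where
    bounds : ∀ i → 1 ≤ i → i ≤ n → i ≤ Δ n lam β i × Δ n lam β i ≤ n
    bounds i 1≤i i≤n = shiftMin-range 1≤i (top-≤ i i≤n) (Δ-isMin i 1≤i i≤n)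
    entries : ∀ i → 1 ≤ i → i ≤ n → 1 ≤ Δ n lam β i × Δ n lam β i ≤ n
    entries i 1≤i i≤n = ≤-trans 1≤i (proj₁ (bounds i 1≤i i≤n)) , proj₂ (bounds i 1≤i i≤n)
    increasing : ∀ i → 1 ≤ i → suc i ≤ n → top i ≡ top (suc i) → Δ n lam β i < Δ n lam β (suc i)
    increasing i 1≤i si≤n same = shiftMin-step (top-≤ i i≤n) (Δ-isMin i 1≤i i≤n)
      (subst (λ b → IsMinOver (shift β (suc i)) (suc i) b (Δ n lam β (suc i))) (sym same) (Δ-isMin (suc i) (s≤s z≤n) si≤n))
      where i≤n = ≤-trans (n≤1+n i) si≤n

  Q : Tab
  Q j i = minFrom (shift β i) i (colLen j ∸ i)

  Q-isMin : ∀ {j i} → Box n lam j i → IsMinOver (shift β i) i (colLen j) (Q j i)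
  Q-isMin {j} {i} b = subst (λ c → IsMinOver (shift β i) i c (Q j i)) (m+[n∸m]≡n (box-in-column b))
    (minFrom-isMin (shift β i) i (colLen j ∸ i))

  Q-tableau : IsTableau n lam Q
  Q-tableau = entries , down , along
    where
    entries : ∀ j i → Box n lam j i → 1 ≤ Q j i × Q j i ≤ n
    entries j i b@((1≤i , _) , _) with shiftMin-range 1≤i (colLen-≤ j) (Q-isMin b)
    ... | i≤Q , Q≤n = ≤-trans 1≤i i≤Q , Q≤n
    down : ∀ j i → Box n lam j i → Box n lam j (suc i) → Q j i < Q j (suc i)
    down j i b b' = shiftMin-step (colLen-≤ j) (Q-isMin b) (Q-isMin b')
    along : ∀ j i → Box n lam j i → Box n lam (suc j) i → Q j i ≤ Q (suc j) i
    along j i b b' = minOver-shrink (colLen-anti j (suc j) (n≤1+n j)) (Q-isMin b) (Q-isMin b')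

  Q-below-β : ∀ {j i} → Box n lam j i → Q j i ≤ β i
  Q-below-β {j} {i} b = subst (Q j i ≤_) (shift-self β i) (proj₂ (Q-isMin b) i ≤-refl (box-in-column b))

  -- every T ∈ 𝒮_λ(β) lies below Q, since T_j(i) + (k − i) ≤ T_j(k) ≤ β_k
  S-below-Q : ∀ T → InS n lam β T → T ⊑ Q
  S-below-Q T (tT , T≤β) j i b@((1≤i , _) , (1≤j , _)) with proj₁ (Q-isMin b)
  ... | k , i≤k , k≤ζ , Q≡ =
    subst (T j i ≤_) (sym (trans Q≡ (sym (shift-≡ β i k i≤k (upper k 1≤k (≤-trans k≤ζ (colLen-≤ j)))))))
      (m+n≤o⇒m≤o∸n (T j i) (≤-trans (column-gap T tT b i≤k k≤ζ) (T≤β j k (box j k 1≤j 1≤k k≤ζ))))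
    where 1≤k = ≤-trans 1≤i i≤k

  S-principal : IsPrincipal (InS n lam β) Q
  S-principal = Q-tableau , λ T → mk⇔ (λ s → proj₁ s , S-below-Q T s)
    (λ { (tT , T⊑Q) → tT , λ j i b → ≤-trans (T⊑Q j i b) (Q-below-β b) })

  -- the last entry of row i of Q is the core, as ζ_{λ_i} ends the carrel of i
  Q-last : ∀ i → 1 ≤ i → i ≤ n → 1 ≤ lam i → Q (lam i) i ≡ Δ n lam β i
  Q-last i 1≤i i≤n 1≤λi = minOver-unique (Q-isMin ((1≤i , i≤n) , (1≤λi , ≤-refl)))
    (subst (λ c → IsMinOver (shift β i) i c (Δ n lam β i)) (top-row i 1≤i i≤n 1≤λi) (Δ-isMin i 1≤i i≤n))

  M-in-S : ∀ T → MSet n lam (Δ n lam β) T → InS n lam β T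
  M-in-S T (tT , last) = tT , bound
    where
    bound : ∀ j i → Box n lam j i → T j i ≤ β i
    bound j i b@((1≤i , i≤n) , (1≤j , j≤λi)) = begin
      T j i          ≤⟨ row-mono T tT b j≤λi ≤-refl ⟩
      T (lam i) i    ≡⟨ last i 1≤i i≤n (≤-trans 1≤j j≤λi) ⟩
      Δ n lam β i    ≤⟨ proj₂ (Δ-isMin i 1≤i i≤n) i ≤-refl (top-≥ i) ⟩
      shift β i i    ≡⟨ shift-self β i ⟩
      β i            ∎
      where open ≤-Reasoning

  max-at : ∀ A → IsTableau n lam A → Q ≈ A → IsMax n lam (MSet n lam (Δ n lam β)) A
  max-at A tA Q≈A =
    (tA , λ i 1≤i i≤n 1≤λi → trans (sym (Q≈A (lam i) i ((1≤i , i≤n) , (1≤λi , ≤-refl)))) (Q-last i 1≤i i≤n 1≤λi)) ,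
    λ T m → ⊑-trans (S-below-Q T (M-in-S T m)) (≈⇒⊑ Q≈A)

  lub-is-max : ∀ A → IsLUB n lam (InS n lam β) A → IsMax n lam (MSet n lam (Δ n lam β)) A
  lub-is-max A lub = max-at A (proj₁ lub) (lub-unique (principal-lub S-principal) lub)

  max-generates : ∀ M → IsMax n lam (MSet n lam (Δ n lam β)) M → IsPrincipal (InS n lam β) M
  max-generates M mx = principal-resp-≈ S-principal (proj₁ (proj₁ mx)) (max-unique (max-at Q Q-tableau ≈-refl) mx)

-- (i) is the statement 𝒮_λ(β) = [Q] transported to any least upper bound;
-- (ii) holds because every least upper bound, and every M_λ(δ), agrees with Q.

proposition12p4 : (n : ℕ) → 1 ≤ n → (lam : ℕ → ℕ) → IsPartition n lam →
    (β β' : ℕ → ℕ) → InU n lam β → InU n lam β' →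
    Σ Tab (IsLUB n lam (InS n lam β)) ×
    (∀ Q → IsLUB n lam (InS n lam β) Q →
       ∀ T → (InS n lam β T ⇔ (IsTableau n lam T × T ≤T[ n , lam ] Q))) ×
    (∀ Q Q' → IsLUB n lam (InS n lam β) Q → IsLUB n lam (InS n lam β') Q' →
       ((∀ T → (InS n lam β T ⇔ InS n lam β' T)) ⇔ Q ≈T[ n , lam ] Q')) ×
    InUI n lam (Δ n lam β) ×
    (∀ Q → IsLUB n lam (InS n lam β) Q → IsMax n lam (MSet n lam (Δ n lam β)) Q) ×
    (∀ M → IsMax n lam (MSet n lam (Δ n lam β)) M →
       ∀ T → (InS n lam β T ⇔ (IsTableau n lam T × T ≤T[ n , lam ] M)))
proposition12p4 n _ lam P β β' U U' =
    (Q , principal-lub S-principal)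
  , (λ Q₁ lub₁ → proj₂ (principal-at-lub S-principal lub₁))
  , (λ Q₁ Q₂ lub₁ lub₂ →
       principal-ext (principal-at-lub S-principal lub₁) (principal-at-lub S′.S-principal lub₂))
  , Δ-inUI
  , lub-is-max
  , (λ M mx → proj₂ (max-generates M mx))
  where
  open Order n lam
  open Bounded n lam P β U
  module S′ = Bounded n lam P β' U'
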